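{- For every integer $x\ge 1$, $$5S_{5,0}(x)-10S_{5,0}(16x)+S_{5,0}(256x)=S_{5,0}(x)+S_{5,1}(x)+S_{5,2}(x)+S_{5,3}(x)+S_{5,4}(x).$$
   Context: For an integer $b\ge 2$ and integer $r\ge 0$, $s_b(r)$ denotes the sum of the digits of $r$ in base $b$. For integers $n\ge 3$, $0\le j\le n-1$ and $x\ge 0$, define $$S_{n,j}(x)=\sum_{0\le r<x,\; r\equiv j \pmod n}(-1)^{s_{n-1}(r)}.$$ -}

module Defs where

open import Data.Nat using (ℕ; zero; suc; _+_; _∸_; _≡ᵇ_; NonZero)
open import Data.Nat.DivMod using (_/_; _%_)
open import Data.Bool using (if_then_else_)
open import Data.Integer using (ℤ; +_; -_; 0ℤ; 1ℤ) renaming (_+_ to _+ℤ_)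

-- digit sum of r in base b, computed with fuel (fuel r suffices since r / b < r for r > 0, b ≥ 2)
digitSumAux : (fuel b : ℕ) → .{{NonZero b}} → ℕ → ℕ
digitSumAux zero b r = 0
digitSumAux (suc fuel) b r = if r ≡ᵇ 0 then 0 else (r % b + digitSumAux fuel b (r / b))

-- s_b(r): sum of the base-b digits of r (intended for b ≥ 2)
s : (b : ℕ) → .{{NonZero b}} → ℕ → ℕ
s b r = digitSumAux r b r

negOnePow : ℕ → ℤ
negOnePow k = if (k % 2) ≡ᵇ 0 then 1ℤ else - 1ℤ

-- S_{n,j}(x) = Σ_{0 ≤ r < x, r ≡ j mod n} (-1)^{s_{n-1}(r)}, for n ≥ 3 written n = suc (suc (suc m))
-- so that the base n-1 = suc (suc m) ≥ 2.
S : (m j x : ℕ) → ℤ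
S m j zero = 0ℤ
S m j (suc r) =
  S m j r +ℤ (if (r % suc (suc (suc m))) ≡ᵇ j then negOnePow (s (suc (suc m)) r) else 0ℤ)

-- Write L(x) = 5 S_{5,0}(x) - 10 S_{5,0}(16x) + S_{5,0}(256x) and
-- R(x) = S_{5,0}(x) + ... + S_{5,4}(x).  Both vanish at x = 0, and we prove
-- L(x+1) - L(x) = R(x+1) - R(x) for every x, which gives L = R by induction.
--
-- The key facts are:
--   * digit sums are additive across aligned blocks: for t < b^k,
--     s_b(t + x b^k) = s_b(t) + s_b(x), hence (-1)^{s_4(x M + t)} =
--     (-1)^{s_4(t)} (-1)^{s_4(x)} for M = 16 or 256;
--   * 16 ≡ 256 ≡ 1 (mod 5), so x M + t ≡ x + t (mod 5).
-- Consequently the new terms of S_{5,0}(Mx) on [Mx, M(x+1)) depend only on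
-- i = x mod 5 and the sign E = (-1)^{s_4(x)}: they form the block sum
-- Σ_{t<M, i+t ≡ 0 mod 5} (-1)^{s_4(t)} E.  The increment identity then reduces to
-- ten closed computations (i < 5, E = ±1), decided by evaluation.
module Submission where

open import Defs
open import Data.Nat using (ℕ; _≤_; _*_)
open import Data.Integer using (ℤ; +_; _+_; _-_) renaming (_*_ to _*ℤ_)
open import Relation.Binary.PropositionalEquality using (_≡_)

open import Data.Nat as ℕ using (zero; suc; _<_; z≤n; s≤s; NonZero; _≡ᵇ_)
open import Data.Nat.Properties as ℕP using (≤-trans; ≤-pred)
open import Data.Nat.DivMod
open import Data.Nat.Divisibility using (divides-refl)
open import Data.Bool using (true; false; if_then_else_)
open import Data.Sum using (_⊎_; inj₁; inj₂)
open import Data.Integer using (0ℤ; 1ℤ; -_)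
open import Relation.Binary.PropositionalEquality
  using (refl; cong; cong₂; sym; trans; subst; module ≡-Reasoning)
import Data.Nat.Solver as ℕS
import Data.Integer.Solver as ℤS
import Data.Integer.Properties as ℤP

module DigitSum (b : ℕ) .{{_ : NonZero b}} (1<b : 1 < b) where

  quotient-< : ∀ r → suc r / b ≤ r
  quotient-< r = ≤-pred (m/n<m (suc r) b 1<b)

  fuel-irrelevant : ∀ f g r → r ≤ f → r ≤ g →
                    digitSumAux f b r ≡ digitSumAux g b r
  fuel-irrelevant f       g       zero    _       _       with f | g
  ... | zero  | zero  = refl
  ... | zero  | suc _ = refl
  ... | suc _ | zero  = refl
  ... | suc _ | suc _ = refl
  fuel-irrelevant (suc f) (suc g) (suc r) (s≤s p) (s≤s q) =
    cong (suc r % b ℕ.+_)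
         (fuel-irrelevant f g (suc r / b) (≤-trans (quotient-< r) p)
                                          (≤-trans (quotient-< r) q))

  s-step : ∀ n → s b n ≡ n % b ℕ.+ s b (n / b)
  s-step zero    = sym (cong₂ ℕ._+_ (m*n%n≡0 0 b) (cong (s b) (0/n≡0 b)))
  s-step (suc r) = cong (suc r % b ℕ.+_)
    (fuel-irrelevant r (suc r / b) (suc r / b) (quotient-< r) ℕP.≤-refl)

  Splits : ℕ → Set
  Splits B = ∀ x t → t < B → s b (t ℕ.+ x * B) ≡ s b t ℕ.+ s b x

  s-digit : ∀ t → t < b → s b t ≡ t
  s-digit t t<b = begin
    s b t                    ≡⟨ s-step t ⟩
    t % b ℕ.+ s b (t / b)    ≡⟨ cong₂ (λ u v → u ℕ.+ s b v) (m<n⇒m%n≡m t<b) (m<n⇒m/n≡0 t<b) ⟩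
    t ℕ.+ 0                  ≡⟨ ℕP.+-identityʳ t ⟩
    t                        ∎
    where open ≡-Reasoning

  splits-base : Splits b
  splits-base x t t<b = begin
    s b (t ℕ.+ x * b)                                    ≡⟨ s-step (t ℕ.+ x * b) ⟩
    (t ℕ.+ x * b) % b ℕ.+ s b ((t ℕ.+ x * b) / b)       ≡⟨ cong₂ (λ u v → u ℕ.+ s b v) last rest ⟩
    t ℕ.+ s b x                                          ≡⟨ cong (ℕ._+ s b x) (sym (s-digit t t<b)) ⟩
    s b t ℕ.+ s b x                                      ∎
    where
    open ≡-Reasoning
    last : (t ℕ.+ x * b) % b ≡ t
    last = trans ([m+kn]%n≡m%n t x b) (m<n⇒m%n≡m t<b)
    rest : (t ℕ.+ x * b) / b ≡ x
    rest = trans (+-distrib-/-∣ʳ t (divides-refl x))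
                 (cong₂ ℕ._+_ (m<n⇒m/n≡0 t<b) (m*n/n≡m x b))

  -- Splitting block sizes are closed under products: write t = d + a B with
  -- d < B and a < C, and split first at B, then at C.
  splits-* : ∀ B C .{{_ : NonZero B}} → Splits B → Splits C → Splits (B * C)
  splits-* B C split-B split-C x t t<BC = begin
    s b (t ℕ.+ x * (B * C))              ≡⟨ cong (s b) regroup ⟩
    s b (d ℕ.+ (a ℕ.+ x * C) * B)        ≡⟨ split-B (a ℕ.+ x * C) d d<B ⟩
    s b d ℕ.+ s b (a ℕ.+ x * C)          ≡⟨ cong (s b d ℕ.+_) (split-C x a a<C) ⟩
    s b d ℕ.+ (s b a ℕ.+ s b x)          ≡⟨ sym (ℕP.+-assoc (s b d) (s b a) (s b x)) ⟩
    (s b d ℕ.+ s b a) ℕ.+ s b x          ≡⟨ cong (ℕ._+ s b x) (sym split-t) ⟩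
    s b t ℕ.+ s b x                      ∎
    where
    open ≡-Reasoning
    d = t % B
    a = t / B
    d<B : d < B
    d<B = m%n<n t B
    a<C : a < C
    a<C = m<n*o⇒m/o<n {t} {C} {B} (subst (t <_) (ℕP.*-comm B C) t<BC)
    split-t : s b t ≡ s b d ℕ.+ s b a
    split-t = trans (cong (s b) (m≡m%n+[m/n]*n t B)) (split-B a d d<B)
    regroup : t ℕ.+ x * (B * C) ≡ d ℕ.+ (a ℕ.+ x * C) * B
    regroup = trans (cong (ℕ._+ x * (B * C)) (m≡m%n+[m/n]*n t B))
      (solve 5 (λ d a x B C → (d :+ a :* B) :+ x :* (B :* C)
                            := d :+ (a :+ x :* C) :* B) refl d a x B C)
      where open ℕS.+-*-Solver

-- From here on n = 5, so digit sums are taken in base n - 1 = 4.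
open DigitSum 4 (s≤s (s≤s z≤n)) using (Splits; splits-base; splits-*)

splits-16 : Splits 16
splits-16 = splits-* 4 4 splits-base splits-base

splits-256 : Splits 256
splits-256 = splits-* 16 16 splits-16 splits-16

negOnePow-+ : ∀ u v → negOnePow (u ℕ.+ v) ≡ negOnePow u *ℤ negOnePow v
negOnePow-+ u v =
  trans (cong (λ r → if r ≡ᵇ 0 then 1ℤ else - 1ℤ) (%-distribˡ-+ u v 2))
        (on-parities (u % 2) (v % 2) (m%n<n u 2) (m%n<n v 2))
  where
  sign : ℕ → ℤ
  sign p = if p ≡ᵇ 0 then 1ℤ else - 1ℤ
  on-parities : ∀ p q → p < 2 → q < 2 → sign ((p ℕ.+ q) % 2) ≡ sign p *ℤ sign q
  on-parities 0 0 _ _ = refl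
  on-parities 0 1 _ _ = refl
  on-parities 1 0 _ _ = refl
  on-parities 1 1 _ _ = refl
  on-parities (suc (suc _)) _ (s≤s (s≤s ())) _
  on-parities _ (suc (suc _)) _ (s≤s (s≤s ()))

-- Every sign is ±1; this reduces the block identity to finitely many cases.
negOnePow-± : ∀ k → (negOnePow k ≡ 1ℤ) ⊎ (negOnePow k ≡ - 1ℤ)
negOnePow-± k with k % 2 ≡ᵇ 0
... | true  = inj₁ refl
... | false = inj₂ refl

sumBelow : ℕ → (ℕ → ℤ) → ℤ
sumBelow zero    g = 0ℤ
sumBelow (suc k) g = sumBelow k g + g k

sumBelow-cong : ∀ k {g h} → (∀ t → t < k → g t ≡ h t) → sumBelow k g ≡ sumBelow k h
sumBelow-cong zero    eq = refl
sumBelow-cong (suc k) eq =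
  cong₂ _+_ (sumBelow-cong k (λ t t<k → eq t (ℕP.m≤n⇒m≤1+n t<k))) (eq k ℕP.≤-refl)

summand : ℕ → ℕ → ℕ → ℤ
summand m j r =
  if (r % suc (suc (suc m))) ≡ᵇ j then negOnePow (s (suc (suc m)) r) else 0ℤ

S-+ : ∀ m j n k → S m j (n ℕ.+ k) ≡ S m j n + sumBelow k (λ t → summand m j (n ℕ.+ t))
S-+ m j n zero    = trans (cong (S m j) (ℕP.+-identityʳ n)) (sym (ℤP.+-identityʳ _))
S-+ m j n (suc k) = begin
  S m j (n ℕ.+ suc k)                                                   ≡⟨ cong (S m j) (ℕP.+-suc n k) ⟩
  S m j (n ℕ.+ k) + summand m j (n ℕ.+ k)                               ≡⟨ cong (_+ summand m j (n ℕ.+ k)) (S-+ m j n k) ⟩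
  (S m j n + sumBelow k (λ t → summand m j (n ℕ.+ t))) + summand m j (n ℕ.+ k) ≡⟨ ℤP.+-assoc (S m j n) _ _ ⟩
  S m j n + sumBelow (suc k) (λ t → summand m j (n ℕ.+ t))              ∎
  where open ≡-Reasoning

-- The summand of S_{5,j} at position x M + t, expressed through the residue
-- i = x mod 5 and the sign E = (-1)^{s_4(x)} of the block index x.
blockTerm : ℕ → ℕ → ℤ → ℕ → ℤ
blockTerm j i E t = if ((i ℕ.+ t) % 5) ≡ᵇ j then negOnePow (s 4 t) *ℤ E else 0ℤ

-- Since M = 5B + 1 ≡ 1 (mod 5), the residue of x M + t is that of x + t.
residue-block : ∀ x B t → (x * (B * 5 ℕ.+ 1) ℕ.+ t) % 5 ≡ (x % 5 ℕ.+ t) % 5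
residue-block x B t = begin
  (x * (B * 5 ℕ.+ 1) ℕ.+ t) % 5     ≡⟨ cong (_% 5) regroup ⟩
  ((x ℕ.+ t) ℕ.+ (x * B) * 5) % 5   ≡⟨ [m+kn]%n≡m%n (x ℕ.+ t) (x * B) 5 ⟩
  (x ℕ.+ t) % 5                     ≡⟨ %-distribˡ-+ x t 5 ⟩
  (x % 5 ℕ.+ t % 5) % 5             ≡⟨ cong (λ r → (r ℕ.+ t % 5) % 5) (sym (m%n%n≡m%n x 5)) ⟩
  (x % 5 % 5 ℕ.+ t % 5) % 5         ≡⟨ sym (%-distribˡ-+ (x % 5) t 5) ⟩
  (x % 5 ℕ.+ t) % 5                 ∎
  where
  open ≡-Reasoning
  regroup : x * (B * 5 ℕ.+ 1) ℕ.+ t ≡ (x ℕ.+ t) ℕ.+ (x * B) * 5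
  regroup = solve 3 (λ x B t → x :* (B :* con 5 :+ con 1) :+ t
                            := (x :+ t) :+ (x :* B) :* con 5) refl x B t
    where open ℕS.+-*-Solver

summand-block : ∀ B → Splits (B * 5 ℕ.+ 1) → ∀ j x t → t < B * 5 ℕ.+ 1 →
  summand 2 j (x * (B * 5 ℕ.+ 1) ℕ.+ t) ≡ blockTerm j (x % 5) (negOnePow (s 4 x)) t
summand-block B splits-M j x t t<M =
  cong₂ (λ r E → if r ≡ᵇ j then E else 0ℤ) (residue-block x B t) sign
  where
  sign : negOnePow (s 4 (x * (B * 5 ℕ.+ 1) ℕ.+ t)) ≡ negOnePow (s 4 t) *ℤ negOnePow (s 4 x)
  sign = trans (cong (λ r → negOnePow (s 4 r)) (ℕP.+-comm (x * (B * 5 ℕ.+ 1)) t))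
               (trans (cong negOnePow (splits-M x t t<M)) (negOnePow-+ (s 4 t) (s 4 x)))

S-block : ∀ B → Splits (B * 5 ℕ.+ 1) → ∀ j x →
  S 2 j ((B * 5 ℕ.+ 1) * suc x)
    ≡ S 2 j ((B * 5 ℕ.+ 1) * x) + sumBelow (B * 5 ℕ.+ 1) (blockTerm j (x % 5) (negOnePow (s 4 x)))
S-block B splits-M j x = begin
  S 2 j (M * suc x)                                       ≡⟨ cong (S 2 j) shift ⟩
  S 2 j (x * M ℕ.+ M)                                     ≡⟨ S-+ 2 j (x * M) M ⟩
  S 2 j (x * M) + sumBelow M (λ t → summand 2 j (x * M ℕ.+ t))
      ≡⟨ cong₂ _+_ (cong (S 2 j) (ℕP.*-comm x M))
                   (sumBelow-cong M (summand-block B splits-M j x)) ⟩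
  S 2 j (M * x) + sumBelow M (blockTerm j (x % 5) (negOnePow (s 4 x))) ∎
  where
  open ≡-Reasoning
  M = B * 5 ℕ.+ 1
  shift : M * suc x ≡ x * M ℕ.+ M
  shift = trans (ℕP.*-suc M x) (trans (ℕP.+-comm M (M * x)) (cong (ℕ._+ M) (ℕP.*-comm M x)))

-- L(x) = combination (S_{5,0}(x)) (S_{5,0}(16x)) (S_{5,0}(256x)), R(x) = sum5 of the S_{5,j}(x);
-- both are additive, so increments can be compared separately.
combination : ℤ → ℤ → ℤ → ℤ
combination a b c = ((+ 5) *ℤ a - (+ 10) *ℤ b) + c

sum5 : ℤ → ℤ → ℤ → ℤ → ℤ → ℤ
sum5 a₀ a₁ a₂ a₃ a₄ = a₀ + a₁ + a₂ + a₃ + a₄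

combination-+ : ∀ a b c a′ b′ c′ →
  combination (a + a′) (b + b′) (c + c′) ≡ combination a b c + combination a′ b′ c′
combination-+ = solve 6 (λ a b c a′ b′ c′ →
    (con (+ 5) :* (a :+ a′) :- con (+ 10) :* (b :+ b′)) :+ (c :+ c′)
    := ((con (+ 5) :* a :- con (+ 10) :* b) :+ c)
       :+ ((con (+ 5) :* a′ :- con (+ 10) :* b′) :+ c′)) refl
  where open ℤS.+-*-Solver

sum5-+ : ∀ a₀ a₁ a₂ a₃ a₄ b₀ b₁ b₂ b₃ b₄ →
  sum5 a₀ a₁ a₂ a₃ a₄ + sum5 b₀ b₁ b₂ b₃ b₄ ≡ sum5 (a₀ + b₀) (a₁ + b₁) (a₂ + b₂) (a₃ + b₃) (a₄ + b₄)
sum5-+ = solve 10 (λ a₀ a₁ a₂ a₃ a₄ b₀ b₁ b₂ b₃ b₄ →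
    (a₀ :+ a₁ :+ a₂ :+ a₃ :+ a₄) :+ (b₀ :+ b₁ :+ b₂ :+ b₃ :+ b₄)
    := (a₀ :+ b₀) :+ (a₁ :+ b₁) :+ (a₂ :+ b₂) :+ (a₃ :+ b₃) :+ (a₄ :+ b₄)) refl
  where open ℤS.+-*-Solver

-- The summand of S_{5,j} at x, as a function of i = x mod 5 and E = (-1)^{s_4(x)}.
atResidue : ℕ → ℕ → ℤ → ℤ
atResidue j i E = if i ≡ᵇ j then E else 0ℤ

increment : ∀ i E → i < 5 → (E ≡ 1ℤ) ⊎ (E ≡ - 1ℤ) →
  combination (atResidue 0 i E) (sumBelow 16 (blockTerm 0 i E)) (sumBelow 256 (blockTerm 0 i E))
    ≡ sum5 (atResidue 0 i E) (atResidue 1 i E) (atResidue 2 i E) (atResidue 3 i E) (atResidue 4 i E)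
increment 0 _ _ (inj₁ refl) = refl
increment 1 _ _ (inj₁ refl) = refl
increment 2 _ _ (inj₁ refl) = refl
increment 3 _ _ (inj₁ refl) = refl
increment 4 _ _ (inj₁ refl) = refl
increment 0 _ _ (inj₂ refl) = refl
increment 1 _ _ (inj₂ refl) = refl
increment 2 _ _ (inj₂ refl) = refl
increment 3 _ _ (inj₂ refl) = refl
increment 4 _ _ (inj₂ refl) = refl
increment (suc (suc (suc (suc (suc _))))) _ (s≤s (s≤s (s≤s (s≤s (s≤s ()))))) _

identity : ∀ x →
  combination (S 2 0 x) (S 2 0 (16 * x)) (S 2 0 (256 * x))
    ≡ sum5 (S 2 0 x) (S 2 1 x) (S 2 2 x) (S 2 3 x) (S 2 4 x)
identity zero    = refl
identity (suc x) = begin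
  combination (S 2 0 (suc x)) (S 2 0 (16 * suc x)) (S 2 0 (256 * suc x))
    ≡⟨ cong₂ (combination (S 2 0 (suc x))) (S-block 3 splits-16 0 x) (S-block 51 splits-256 0 x) ⟩
  combination (S 2 0 x + atResidue 0 i E) (S 2 0 (16 * x) + block₁₆) (S 2 0 (256 * x) + block₂₅₆)
    ≡⟨ combination-+ (S 2 0 x) (S 2 0 (16 * x)) (S 2 0 (256 * x)) (atResidue 0 i E) block₁₆ block₂₅₆ ⟩
  combination (S 2 0 x) (S 2 0 (16 * x)) (S 2 0 (256 * x))
    + combination (atResidue 0 i E) block₁₆ block₂₅₆
    ≡⟨ cong₂ _+_ (identity x) (increment i E (m%n<n x 5) (negOnePow-± (s 4 x))) ⟩
  sum5 (S 2 0 x) (S 2 1 x) (S 2 2 x) (S 2 3 x) (S 2 4 x)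
    + sum5 (atResidue 0 i E) (atResidue 1 i E) (atResidue 2 i E) (atResidue 3 i E) (atResidue 4 i E)
    ≡⟨ sum5-+ (S 2 0 x) (S 2 1 x) (S 2 2 x) (S 2 3 x) (S 2 4 x)
              (atResidue 0 i E) (atResidue 1 i E) (atResidue 2 i E) (atResidue 3 i E) (atResidue 4 i E) ⟩
  sum5 (S 2 0 (suc x)) (S 2 1 (suc x)) (S 2 2 (suc x)) (S 2 3 (suc x)) (S 2 4 (suc x)) ∎
  where
  open ≡-Reasoning
  i = x % 5
  E = negOnePow (s 4 x)
  block₁₆ block₂₅₆ : ℤ
  block₁₆  = sumBelow 16 (blockTerm 0 i E)
  block₂₅₆ = sumBelow 256 (blockTerm 0 i E)

mainTheorem2 : (x : ℕ) → 1 ≤ x →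
    ((+ 5) *ℤ S 2 0 x - (+ 10) *ℤ S 2 0 (16 * x)) + S 2 0 (256 * x)
      ≡ S 2 0 x + S 2 1 x + S 2 2 x + S 2 3 x + S 2 4 x
mainTheorem2 x _ = identity x
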